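{- For all fixed $k,\ell \in \mathbb{N}$ with $k\geq \ell+1$, there exists a chordal graph $G_{k,\ell}$ and a super-orientation $D_{k,\ell}$ of $G_{k,\ell}$ such that $\omega(G_{k,\ell}) = k$, $\Delta(B(D_{k,\ell})) = \ell$ and $\vec{\chi}(D_{k,\ell}) = \left\lceil \frac{k + \ell}{2} \right\rceil$.
   Context: A graph is chordal if it has no induced cycle of length at least 4. For a digraph $D$, the underlying graph $\mathrm{UG}(D)$ has vertex set $V(D)$ and $uv$ is an edge iff $uv$ or $vu$ is an arc of $D$; $D$ is a super-orientation of $G$ if $G=\mathrm{UG}(D)$. $B(D)$ is the undirected graph on $V(D)$ in which $uv$ is an edge iff both $uv$ and $vu$ are arcs of $D$. $\Delta$ denotes maximum degree and $\omega$ the clique number. A $k$-dicolouring of $D$ is a map $V(D)\to[k]$ such that each colour class induces an acyclic subdigraph; the dichromatic number $\vec{\chi}(D)$ is the least such $k$. -}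

module Defs where

open import Data.Nat using (ℕ; zero; suc; _+_; _≤_)
open import Data.Bool using (Bool; true; false; _∧_; _∨_; if_then_else_)
open import Data.Fin using (Fin; toℕ)
open import Data.List using (List; map; allFin)
open import Data.Nat.ListAction using (sum)
open import Data.Product using (Σ; ∃; _×_; _,_)
open import Data.Sum using (_⊎_)
open import Relation.Binary.PropositionalEquality using (_≡_; _≢_)
open import Relation.Nullary using (¬_)
open import Function.Definitions using (Injective)
open import Function.Bundles using (_⇔_)

record Graph (n : ℕ) : Set where
  field
    adj    : Fin n → Fin n → Bool
    sym    : ∀ u v → adj u v ≡ adj v u
    irrefl : ∀ v → adj v v ≡ false
open Graph public

-- Digraph on Fin n: loopless, at most one arc per ordered pair (digons allowed).
record Digraph (n : ℕ) : Set where
  field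
    arc      : Fin n → Fin n → Bool
    loopless : ∀ v → arc v v ≡ false
open Digraph public

IsSuperOrientation : ∀ {n} → Graph n → Digraph n → Set
IsSuperOrientation G D = ∀ u v → adj G u v ≡ (arc D u v ∨ arc D v u)

bAdj : ∀ {n} → Digraph n → Fin n → Fin n → Bool
bAdj D u v = arc D u v ∧ arc D v u

degB : ∀ {n} → Digraph n → Fin n → ℕ
degB {n} D v = sum (map (λ u → if bAdj D v u then 1 else 0) (allFin n))

MaxDegB≡ : ∀ {n} → Digraph n → ℕ → Set
MaxDegB≡ {n} D ℓ = (∀ v → degB D v ≤ ℓ) × ∃ λ v → degB D v ≡ ℓ

CycSucc : (m : ℕ) → Fin m → Fin m → Set
CycSucc m i j = (suc (toℕ i) ≡ toℕ j) ⊎ ((suc (toℕ i) ≡ m) × (toℕ j ≡ 0))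

CycAdj : (m : ℕ) → Fin m → Fin m → Set
CycAdj m i j = CycSucc m i j ⊎ CycSucc m j i

InducedCycle : ∀ {n} → Graph n → ℕ → Set
InducedCycle {n} G m = Σ (Fin m → Fin n) λ c →
  Injective _≡_ _≡_ c × (∀ i j → (adj G (c i) (c j) ≡ true) ⇔ CycAdj m i j)

Chordal : ∀ {n} → Graph n → Set
Chordal G = ∀ m → 4 ≤ m → ¬ InducedCycle G m

HasClique : ∀ {n} → Graph n → ℕ → Set
HasClique {n} G k = Σ (Fin k → Fin n) λ f →
  Injective _≡_ _≡_ f × (∀ i j → i ≢ j → adj G (f i) (f j) ≡ true)

CliqueNumber≡ : ∀ {n} → Graph n → ℕ → Set
CliqueNumber≡ G k = HasClique G k × (∀ j → HasClique G j → j ≤ k)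

-- A directed cycle of length m ≥ 2 in D (digons are cycles of length 2)
-- all of whose vertices lie in colour class `a` of colouring col.
MonoDiCycle : ∀ {n k} → Digraph n → (Fin n → Fin k) → Fin k → ℕ → Set
MonoDiCycle {n} D col a m = 2 ≤ m × Σ (Fin m → Fin n) λ c →
  Injective _≡_ _≡_ c × (∀ i j → CycSucc m i j → arc D (c i) (c j) ≡ true)
                      × (∀ i → col (c i) ≡ a)

IsDicolouring : ∀ {n} → Digraph n → (k : ℕ) → (Fin n → Fin k) → Set
IsDicolouring D k col = ∀ a m → ¬ MonoDiCycle D col a m

HasDicolouring : ∀ {n} → Digraph n → ℕ → Set
HasDicolouring {n} D k = Σ (Fin n → Fin k) (IsDicolouring D k)

Dichromatic≡ : ∀ {n} → Digraph n → ℕ → Set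
Dichromatic≡ D k = HasDicolouring D k × (∀ j → HasDicolouring D j → k ≤ j)

{-# OPTIONS --safe #-}
-- Realisations are built by induction on k, starting from the complete symmetric digraph on ℓ + 1
-- vertices (k = ℓ + 1) or that digraph dominating one extra vertex (k = ℓ + 2). The inductive step
-- takes a realisation D₀ and adds a hub, a core copy of D₀ and, for every core vertex u, a petal copy
-- of D₀, with single arcs from the hub to the core, from each core vertex u to its petal, and from the
-- petals to the hub. The underlying graph stays chordal (hub, core, petals is a perfect
-- elimination ordering), ω grows by 2 (hub, u and a clique of its petal), B(D) gains no edges, and
-- χ⃗ grows by exactly 1: one new colour for the hub suffices, while with only χ⃗(D₀) colours every
-- colour occurs in the core and in every petal, forcing a monochromatic triangle hub → u → w → hub.
-- Chordality, ω and χ⃗ are certified rather than computed: by a perfect elimination ordering, by a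
-- labelling that is injective on lower neighbourhoods, and by ranks increasing along monochromatic arcs.

module Submission where

open import Defs hiding (sym)
open import Data.Nat using (ℕ; zero; suc; _+_; _*_; _∸_; _≤_; _<_; z≤n; s≤s; ⌈_/2⌉; ⌊_/2⌋; _≤?_; _<?_)
open import Data.Nat.Properties hiding (_≟_)
open import Data.Bool using (Bool; true; false; _∧_; _∨_; not; if_then_else_)
open import Data.Bool.Properties using (∨-comm; ∧-zeroʳ)
open import Data.Fin using (Fin; zero; suc; toℕ; fromℕ; fromℕ<; splitAt; join; _↑ˡ_; _↑ʳ_; combine; remQuot; punchIn; punchOut)
open import Data.Fin.Properties
  using (_≟_; toℕ-injective; toℕ<n; toℕ-fromℕ; toℕ-fromℕ<; splitAt-↑ˡ; splitAt-↑ʳ; join-splitAt; remQuot-combine; combine-remQuot;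
         any?; punchIn-punchOut; injective⇒≤)
  renaming (suc-injective to Fin-suc-injective)
open import Data.List using (tabulate)
open import Data.List.Properties using (map-tabulate)
open import Data.Nat.ListAction using (sum)
open import Data.Product using (Σ; ∃; _×_; _,_; proj₁; proj₂; uncurry)
open import Data.Sum using (_⊎_; inj₁; inj₂)
open import Data.Empty using (⊥; ⊥-elim)
open import Relation.Binary.PropositionalEquality
open import Relation.Nullary using (¬_; yes; no; does)
open import Relation.Nullary.Decidable using (dec-true; dec-false)
open import Function.Definitions using (Injective)
open import Function.Bundles using (Equivalence)

∑ : ∀ n → (Fin n → ℕ) → ℕ
∑ n f = sum (tabulate f)

∑-cong : ∀ n {f g : Fin n → ℕ} → (∀ i → f i ≡ g i) → ∑ n f ≡ ∑ n g
∑-cong zero    _   = refl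
∑-cong (suc n) f≗g = cong₂ _+_ (f≗g zero) (∑-cong n (λ i → f≗g (suc i)))

∑-zeros : ∀ n {f : Fin n → ℕ} → (∀ i → f i ≡ 0) → ∑ n f ≡ 0
∑-zeros zero    _  = refl
∑-zeros (suc n) f0 = cong₂ _+_ (f0 zero) (∑-zeros n (λ i → f0 (suc i)))

∑-↑ : ∀ m n (f : Fin (m + n) → ℕ) → ∑ (m + n) f ≡ ∑ m (λ i → f (i ↑ˡ n)) + ∑ n (λ j → f (m ↑ʳ j))
∑-↑ zero    n f = refl
∑-↑ (suc m) n f = trans (cong (f zero +_) (∑-↑ m n (λ i → f (suc i)))) (sym (+-assoc (f zero) _ _))

∑-combine : ∀ m n (f : Fin (m * n) → ℕ) → ∑ (m * n) f ≡ ∑ m (λ i → ∑ n (λ j → f (combine i j)))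
∑-combine zero    n f = refl
∑-combine (suc m) n f = trans (∑-↑ n (m * n) f) (cong (∑ n (λ j → f (j ↑ˡ m * n)) +_) (∑-combine m n (λ p → f (n ↑ʳ p))))

∑-single : ∀ n (a : Fin n) x → ∑ n (λ u → if does (a ≟ u) then x else 0) ≡ x
∑-single (suc n) zero    x = trans (cong (x +_) (∑-zeros n (λ _ → refl))) (+-identityʳ x)
∑-single (suc n) (suc a) x = ∑-single n a x

∑-ones : ∀ n → ∑ n (λ _ → 1) ≡ n
∑-ones zero    = refl
∑-ones (suc n) = cong suc (∑-ones n)

∑-all-but-one : ∀ n (a : Fin (suc n)) → ∑ (suc n) (λ u → if does (a ≟ u) then 0 else 1) ≡ n
∑-all-but-one n       zero    = ∑-ones n
∑-all-but-one (suc n) (suc a) = cong suc (∑-all-but-one n a)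

degB≡∑ : ∀ {n} (D : Digraph n) v → degB D v ≡ ∑ n (λ u → if bAdj D v u then 1 else 0)
degB≡∑ {n} D v = cong sum (map-tabulate {n = n} (λ u → u) (λ u → if bAdj D v u then 1 else 0))

CycStep : ℕ → ℕ → ℕ → Set
CycStep m x y = (suc x ≡ y) ⊎ ((suc x ≡ m) × (y ≡ 0))

suc[k+x]≢x : ∀ (k x : ℕ) → suc (k + x) ≢ x
suc[k+x]≢x k zero    ()
suc[k+x]≢x k (suc x) eq = suc[k+x]≢x k x (suc-injective (trans (cong suc (sym (+-suc k x))) eq))

cycStep-functional : ∀ {m x y y′ : ℕ} → CycStep m x y → CycStep m x y′ → y < m → y′ < m → y ≡ y′
cycStep-functional (inj₁ p)           (inj₁ q)           _   _   = trans (sym p) q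
cycStep-functional (inj₁ refl)        (inj₂ (refl , _))  y<m _   = ⊥-elim (<-irrefl refl y<m)
cycStep-functional (inj₂ (refl , _))  (inj₁ refl)        _   y<m = ⊥-elim (<-irrefl refl y<m)
cycStep-functional (inj₂ (_ , p))     (inj₂ (_ , q))     _   _   = trans p (sym q)

cycStep-loop⇒m≤1 : ∀ {m x : ℕ} → CycStep m x x → m ≤ 1
cycStep-loop⇒m≤1 {x = x} (inj₁ p)  = ⊥-elim (suc[k+x]≢x 0 x p)
cycStep-loop⇒m≤1 (inj₂ (refl , refl)) = ≤-refl

cycStep-2cycle⇒m≤2 : ∀ {m x y : ℕ} → CycStep m x y → CycStep m y x → m ≤ 2
cycStep-2cycle⇒m≤2 {x = x} (inj₁ refl) (inj₁ p)           = ⊥-elim (suc[k+x]≢x 1 x p)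
cycStep-2cycle⇒m≤2 (inj₁ refl)          (inj₂ (refl , refl)) = ≤-refl
cycStep-2cycle⇒m≤2 (inj₂ (refl , refl)) (inj₁ refl)          = ≤-refl
cycStep-2cycle⇒m≤2 (inj₂ (refl , refl)) (inj₂ (refl , refl)) = s≤s z≤n

cycStep-3cycle⇒m≤3 : ∀ {m x y z : ℕ} → CycStep m x y → CycStep m y z → CycStep m z x → m ≤ 3
cycStep-3cycle⇒m≤3 {x = x} (inj₁ refl) (inj₁ refl) (inj₁ p)  = ⊥-elim (suc[k+x]≢x 2 x p)
cycStep-3cycle⇒m≤3 (inj₁ refl) (inj₁ refl) (inj₂ (refl , refl)) = ≤-refl
cycStep-3cycle⇒m≤3 (inj₁ refl) (inj₂ (refl , refl)) (inj₁ refl) = ≤-refl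
cycStep-3cycle⇒m≤3 (inj₁ refl) (inj₂ (refl , refl)) (inj₂ (() , _))
cycStep-3cycle⇒m≤3 (inj₂ (refl , refl)) (inj₁ refl) (inj₁ refl) = ≤-refl
cycStep-3cycle⇒m≤3 (inj₂ (refl , refl)) (inj₁ refl) (inj₂ (refl , ()))
cycStep-3cycle⇒m≤3 (inj₂ (refl , refl)) (inj₂ (refl , refl)) _  = s≤s z≤n

cycSucc-exists : ∀ m (i : Fin (suc m)) → ∃ λ j → CycSucc (suc m) i j
cycSucc-exists m i with suc (toℕ i) <? suc m
... | yes lt = fromℕ< lt , inj₁ (sym (toℕ-fromℕ< lt))
... | no ¬lt = zero , inj₂ (≤-antisym (toℕ<n i) (≮⇒≥ ¬lt) , refl)

cycPred-exists : ∀ m (i : Fin (suc m)) → ∃ λ j → CycSucc (suc m) j i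
cycPred-exists m i with toℕ i in eq
... | zero  = fromℕ m , inj₂ (cong suc (toℕ-fromℕ m) , refl)
... | suc t = fromℕ< t<1+m , inj₁ (cong suc (toℕ-fromℕ< t<1+m))
  where t<1+m : t < suc m
        t<1+m = <-trans (n<1+n t) (subst (_< suc m) eq (toℕ<n i))

argmax : ∀ m (f : Fin (suc m) → ℕ) → ∃ λ i → ∀ j → f j ≤ f i
argmax zero    f = zero , λ { zero → ≤-refl }
argmax (suc m) f with argmax m (λ i → f (suc i))
... | i , max with f zero ≤? f (suc i)
...   | yes f0≤ = suc i , λ { zero → f0≤ ; (suc j) → max j }
...   | no  f0≰ = zero  , λ { zero → ≤-refl ; (suc j) → ≤-trans (max j) (<⇒≤ (≰⇒> f0≰)) }

UG : ∀ {n} → Digraph n → Graph n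
UG D = record
  { adj    = λ u v → arc D u v ∨ arc D v u
  ; sym    = λ u v → ∨-comm (arc D u v) (arc D v u)
  ; irrefl = λ v → cong₂ _∨_ (loopless D v) (loopless D v)
  }

module _ {A : Set} (arrow : A → A → Bool) where

  Adjacent : A → A → Set
  Adjacent u v = arrow u v ∨ arrow v u ≡ true

  LowerNeighbour : (A → ℕ) → A → A → Set
  LowerNeighbour h v u = Adjacent u v × h u < h v

  ClosedLowerNeighbour : (A → ℕ) → A → A → Set
  ClosedLowerNeighbour h v u = u ≡ v ⊎ LowerNeighbour h v u

  ProperHeights : (A → ℕ) → Set
  ProperHeights h = ∀ u v → Adjacent u v → h u ≢ h v

  -- h orders the vertices as a perfect elimination ordering.
  SimplicialHeights : (A → ℕ) → Set
  SimplicialHeights h = ∀ v u w → LowerNeighbour h v u → LowerNeighbour h v w → u ≢ w → Adjacent u w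

  -- lab v is injective on the closed lower neighbourhood of v, which therefore has at most k vertices.
  LowerLabelling : ∀ {k} → (A → ℕ) → (A → A → Fin k) → Set
  LowerLabelling h lab = ∀ v u u′ → ClosedLowerNeighbour h v u → ClosedLowerNeighbour h v u′ → lab v u ≡ lab v u′ → u ≡ u′

  Adjacent-sym : ∀ {u v} → Adjacent u v → Adjacent v u
  Adjacent-sym {u} {v} uv = trans (∨-comm (arrow v u) (arrow u v)) uv

  Ranked : ∀ {c} → (A → Fin c) → (A → ℕ) → Set
  Ranked col r = ∀ u v → arrow u v ≡ true → col u ≡ col v → r u < r v

module _ {n} (D : Digraph n) where

  arc⇒≢ : ∀ {u v} → arc D u v ≡ true → u ≢ v
  arc⇒≢ {u} uv refl with trans (sym uv) (loopless D u)
  ... | ()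

  adjacent⇒≢ : ∀ {u v} → Adjacent (arc D) u v → u ≢ v
  adjacent⇒≢ {u} uv refl with trans (sym uv) (cong₂ _∨_ (loopless D u) (loopless D u))
  ... | ()

  -- The two cycle-neighbours of the highest vertex of an induced cycle are lower, hence adjacent.
  simplicialHeights⇒chordal : ∀ {h} → ProperHeights (arc D) h → SimplicialHeights (arc D) h → Chordal (UG D)
  simplicialHeights⇒chordal {h} proper simplicial (suc m) 4≤m (c , c-inj , c-adj) =
    non-consecutive (Equivalence.to (c-adj p s) p-s)
    where
    top = argmax m (λ i → h (c i))
    t = proj₁ top
    p = proj₁ (cycPred-exists m t)
    s = proj₁ (cycSucc-exists m t)
    p→t = proj₂ (cycPred-exists m t)
    t→s = proj₂ (cycSucc-exists m t)
    lower : ∀ {i} → Adjacent (arc D) (c i) (c t) → LowerNeighbour (arc D) h (c t) (c i)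
    lower {i} adj = adj , ≤∧≢⇒< (proj₂ top i) (proper _ _ adj)
    p≢s : c p ≢ c s
    p≢s eq = <⇒≱ (≤-trans (s≤s (s≤s (s≤s z≤n))) 4≤m)
                 (cycStep-2cycle⇒m≤2 p→t (subst (CycSucc (suc m) t) (sym (c-inj eq)) t→s))
    p-s : Adjacent (arc D) (c p) (c s)
    p-s = simplicial (c t) (c p) (c s) (lower (Equivalence.from (c-adj p t) (inj₁ p→t)))
                                       (lower (Equivalence.from (c-adj s t) (inj₂ t→s))) p≢s
    non-consecutive : ¬ CycAdj (suc m) p s
    non-consecutive (inj₁ p→s) with cycStep-functional p→s p→t (toℕ<n s) (toℕ<n t)
    ... | s≡t = <⇒≱ (≤-trans (s≤s (s≤s z≤n)) 4≤m) (cycStep-loop⇒m≤1 (subst (CycStep (suc m) (toℕ t)) s≡t t→s))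
    non-consecutive (inj₂ s→p) = <⇒≱ 4≤m (cycStep-3cycle⇒m≤3 p→t t→s s→p)

  -- The top vertex of a clique sees all the others as lower neighbours.
  lowerLabelling⇒clique≤ : ∀ {k h} {lab : Fin n → Fin n → Fin k} → ProperHeights (arc D) h → LowerLabelling (arc D) h lab →
                           ∀ j → HasClique (UG D) j → j ≤ k
  lowerLabelling⇒clique≤ proper labelling zero    _                  = z≤n
  lowerLabelling⇒clique≤ {h = h} {lab} proper labelling (suc j) (f , f-inj , f-adj) =
    injective⇒≤ {f = λ i → lab (f t) (f i)} (λ {x} {y} eq → f-inj (labelling (f t) (f x) (f y) (closed x) (closed y) eq))
    where
    top = argmax j (λ i → h (f i))
    t = proj₁ top
    closed : ∀ i → ClosedLowerNeighbour (arc D) h (f t) (f i)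
    closed i with i ≟ t
    ... | yes refl = inj₁ refl
    ... | no  i≢t  = inj₂ (f-adj i t i≢t , ≤∧≢⇒< (proj₂ top i) (proper _ _ (f-adj i t i≢t)))

  ranked⇒dicolouring : ∀ {c} {col : Fin n → Fin c} {r} → Ranked (arc D) col r → IsDicolouring D c col
  ranked⇒dicolouring {r = r} ranked a (suc m) (_ , cy , _ , cy-arc , cy-col) = <-irrefl refl (≤-trans t<s (proj₂ top s))
    where
    top = argmax m (λ i → r (cy i))
    t = proj₁ top
    s = proj₁ (cycSucc-exists m t)
    t<s : r (cy t) < r (cy s)
    t<s = ranked _ _ (cy-arc t s (proj₂ (cycSucc-exists m t))) (trans (cy-col t) (sym (cy-col s)))

  dicolouring-pullback : ∀ {m} (D′ : Digraph m) (e : Fin n → Fin m) → Injective _≡_ _≡_ e →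
                         (∀ x y → arc D x y ≡ true → arc D′ (e x) (e y) ≡ true) →
                         ∀ {k col} → IsDicolouring D′ k col → IsDicolouring D k (λ x → col (e x))
  dicolouring-pullback D′ e e-inj e-arc dic a m (2≤m , cy , cy-inj , cy-arc , cy-col) =
    dic a m (2≤m , (λ i → e (cy i)) , (λ eq → cy-inj (e-inj eq)) , (λ i j i→j → e-arc _ _ (cy-arc i j i→j)) , cy-col)

  no-monochromatic-dicycle : ∀ {k col} → IsDicolouring D k col → ∀ m (cy : Fin (suc (suc m)) → Fin n) →
                             Injective _≡_ _≡_ cy → (∀ i → arc D (cy i) (cy (proj₁ (cycSucc-exists (suc m) i))) ≡ true) →
                             (∀ i → col (cy i) ≡ col (cy zero)) → ⊥
  no-monochromatic-dicycle dic m cy cy-inj cy-arc cy-col =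
    dic _ (suc (suc m)) (s≤s (s≤s z≤n) , cy , cy-inj , cy-arc′ , cy-col)
    where
    cy-arc′ : ∀ i j → CycSucc (suc (suc m)) i j → arc D (cy i) (cy j) ≡ true
    cy-arc′ i j i→j = subst (λ j → arc D (cy i) (cy j) ≡ true)
      (toℕ-injective (cycStep-functional (proj₂ (cycSucc-exists (suc m) i)) i→j (toℕ<n _) (toℕ<n j))) (cy-arc i)

  no-monochromatic-digon : ∀ {k col x y} → IsDicolouring D k col → arc D x y ≡ true → arc D y x ≡ true → col y ≢ col x
  no-monochromatic-digon {col = col} {x} {y} dic xy yx same = no-monochromatic-dicycle dic 0 cy cy-inj cy-arc cy-col
    where
    cy : Fin 2 → Fin n
    cy zero    = x
    cy (suc _) = y
    cy-inj : Injective _≡_ _≡_ cy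
    cy-inj {zero}     {zero}     _  = refl
    cy-inj {zero}     {suc zero} eq = ⊥-elim (arc⇒≢ xy eq)
    cy-inj {suc zero} {zero}     eq = ⊥-elim (arc⇒≢ yx eq)
    cy-inj {suc zero} {suc zero} _  = refl
    cy-arc : ∀ i → arc D (cy i) (cy (proj₁ (cycSucc-exists 1 i))) ≡ true
    cy-arc zero       = xy
    cy-arc (suc zero) = yx
    cy-col : ∀ i → col (cy i) ≡ col x
    cy-col zero       = refl
    cy-col (suc zero) = same

  no-monochromatic-triangle : ∀ {k col x y z} → IsDicolouring D k col →
                              arc D x y ≡ true → arc D y z ≡ true → arc D z x ≡ true →
                              col y ≡ col x → col z ≡ col x → ⊥
  no-monochromatic-triangle {col = col} {x} {y} {z} dic xy yz zx yx zx′ =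
    no-monochromatic-dicycle dic 1 cy cy-inj cy-arc cy-col
    where
    cy : Fin 3 → Fin n
    cy zero          = x
    cy (suc zero)    = y
    cy (suc (suc _)) = z
    cy-inj : Injective _≡_ _≡_ cy
    cy-inj {zero}          {zero}          _  = refl
    cy-inj {zero}          {suc zero}      eq = ⊥-elim (arc⇒≢ xy eq)
    cy-inj {zero}          {suc (suc zero)} eq = ⊥-elim (arc⇒≢ zx (sym eq))
    cy-inj {suc zero}      {zero}          eq = ⊥-elim (arc⇒≢ xy (sym eq))
    cy-inj {suc zero}      {suc zero}      _  = refl
    cy-inj {suc zero}      {suc (suc zero)} eq = ⊥-elim (arc⇒≢ yz eq)
    cy-inj {suc (suc zero)} {zero}          eq = ⊥-elim (arc⇒≢ zx eq)
    cy-inj {suc (suc zero)} {suc zero}      eq = ⊥-elim (arc⇒≢ yz (sym eq))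
    cy-inj {suc (suc zero)} {suc (suc zero)} _ = refl
    cy-arc : ∀ i → arc D (cy i) (cy (proj₁ (cycSucc-exists 2 i))) ≡ true
    cy-arc zero             = xy
    cy-arc (suc zero)       = yz
    cy-arc (suc (suc zero)) = zx
    cy-col : ∀ i → col (cy i) ≡ col x
    cy-col zero             = refl
    cy-col (suc zero)       = yx
    cy-col (suc (suc zero)) = zx′

  symmetricClique⇒dichromatic≥ : ∀ {p} (e : Fin p → Fin n) → (∀ a b → a ≢ b → arc D (e a) (e b) ≡ true) →
                                  ∀ j → HasDicolouring D j → p ≤ j
  symmetricClique⇒dichromatic≥ e e-arc j (col , dic) = injective⇒≤ {f = λ a → col (e a)} col∘e-inj
    where
    col∘e-inj : ∀ {a b} → col (e a) ≡ col (e b) → a ≡ b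
    col∘e-inj {a} {b} same with a ≟ b
    ... | yes a≡b = a≡b
    ... | no  a≢b = ⊥-elim (no-monochromatic-digon {col = col} dic (e-arc a b a≢b) (e-arc b a (λ eq → a≢b (sym eq))) (sym same))

  -- A colour missed by a dicolouring can be squeezed out with punchOut.
  minimumDicolouring-surjective : ∀ {c} → (∀ j → HasDicolouring D j → c ≤ j) →
                                  ∀ {j col} → IsDicolouring D j col → j ≤ c → ∀ a → ∃ λ v → col v ≡ a
  minimumDicolouring-surjective {c} minimum {suc j} {col} dic j<c a with any? (λ v → col v ≟ a)
  ... | yes hit = hit
  ... | no miss = ⊥-elim (<⇒≱ j<c (minimum j (squeezed , squeezed-dic)))
    where
    a≢col : ∀ v → a ≢ col v
    a≢col v eq = miss (v , sym eq)
    squeezed : Fin n → Fin j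
    squeezed v = punchOut (a≢col v)
    squeezed-dic : IsDicolouring D j squeezed
    squeezed-dic b m (2≤m , cy , cy-inj , cy-arc , cy-col) =
      dic (punchIn a b) m (2≤m , cy , cy-inj , cy-arc ,
           λ i → trans (sym (punchIn-punchOut (a≢col (cy i)))) (cong (punchIn a) (cy-col i)))

-- The bounds on heights and ranks let the extension place the petal copies above the core.
record Realisation (k ℓ c : ℕ) : Set where
  field
    n               : ℕ
    D               : Digraph n
    height          : Fin n → ℕ
    heightBound     : ℕ
    height<         : ∀ v → height v < heightBound
    proper          : ProperHeights (arc D) height
    simplicial      : SimplicialHeights (arc D) height
    label           : Fin n → Fin n → Fin k
    lowerLabelling  : LowerLabelling (arc D) height label
    clique          : HasClique (UG D) k
    colour          : Fin n → Fin c
    rank            : Fin n → ℕ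
    rankBound       : ℕ
    rank<           : ∀ v → rank v < rankBound
    ranked          : Ranked (arc D) colour rank
    dichromatic≥    : ∀ j → HasDicolouring D j → c ≤ j
    degB≤           : ∀ v → degB D v ≤ ℓ
    degB≡           : ∃ λ v → degB D v ≡ ℓ

realisation⇒example : ∀ {k ℓ c} → Realisation k ℓ c →
  Σ ℕ λ n → Σ (Graph n) λ G → Σ (Digraph n) λ D →
    Chordal G × IsSuperOrientation G D × CliqueNumber≡ G k × MaxDegB≡ D ℓ × Dichromatic≡ D c
realisation⇒example R =
  n , UG D , D , simplicialHeights⇒chordal D proper simplicial , (λ _ _ → refl) ,
  (clique , lowerLabelling⇒clique≤ D proper lowerLabelling) , (degB≤ , degB≡) ,
  ((colour , ranked⇒dicolouring D ranked) , dichromatic≥)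
  where open Realisation R

module CompleteUnderlyingGraph {n} (D : Digraph n) (complete : ∀ u v → u ≢ v → Adjacent (arc D) u v) where

  proper : ProperHeights (arc D) toℕ
  proper u v uv eq = adjacent⇒≢ D uv (toℕ-injective eq)

  simplicial : SimplicialHeights (arc D) toℕ
  simplicial _ u w _ _ u≢w = complete u w u≢w

  lowerLabelling : LowerLabelling (arc D) toℕ (λ _ u → u)
  lowerLabelling _ _ _ _ _ eq = eq

  clique : HasClique (UG D) n
  clique = (λ u → u) , (λ eq → eq) , complete

distinct : ∀ {n} → Fin n → Fin n → Bool
distinct u v = not (does (u ≟ v))

distinct-irrefl : ∀ {n} (v : Fin n) → distinct v v ≡ false
distinct-irrefl v = cong not (dec-true (v ≟ v) refl)

≢⇒distinct : ∀ {n} {u v : Fin n} → u ≢ v → distinct u v ≡ true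
≢⇒distinct {u = u} {v} u≢v = cong not (dec-false (u ≟ v) u≢v)

digonIndicator-distinct : ∀ {n} (v u : Fin n) →
  (if distinct v u ∧ distinct u v then 1 else 0) ≡ (if does (v ≟ u) then 0 else 1)
digonIndicator-distinct v u with v ≟ u
... | yes refl = refl
... | no  v≢u  rewrite ≢⇒distinct (λ u≡v → v≢u (sym u≡v)) = refl

module CompleteSymmetric (ℓ : ℕ) where

  D : Digraph (suc ℓ)
  D = record { arc = distinct ; loopless = distinct-irrefl }

  open CompleteUnderlyingGraph D (λ u v u≢v → cong (_∨ distinct v u) (≢⇒distinct {u = u} u≢v))

  ranked : Ranked distinct (λ v → v) (λ _ → 0)
  ranked u _ uv refl = ⊥-elim (arc⇒≢ D {u} uv refl)

  degB≡ℓ : ∀ v → degB D v ≡ ℓ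
  degB≡ℓ v = trans (degB≡∑ D v) (trans (∑-cong (suc ℓ) (digonIndicator-distinct v)) (∑-all-but-one ℓ v))

  realisation : Realisation (suc ℓ) ℓ (suc ℓ)
  realisation = record
    { n = suc ℓ ; D = D
    ; height = toℕ ; heightBound = suc ℓ ; height< = toℕ<n ; proper = proper ; simplicial = simplicial
    ; label = λ _ u → u ; lowerLabelling = lowerLabelling ; clique = clique
    ; colour = λ v → v ; rank = λ _ → 0 ; rankBound = 1 ; rank< = λ _ → s≤s z≤n ; ranked = ranked
    ; dichromatic≥ = symmetricClique⇒dichromatic≥ D (λ v → v) (λ a b → ≢⇒distinct {u = a} {b})
    ; degB≤ = λ v → ≤-reflexive (degB≡ℓ v) ; degB≡ = zero , degB≡ℓ zero
    }

module CompleteSymmetricWithSink (ℓ : ℕ) where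

  arrow : Fin (suc (suc ℓ)) → Fin (suc (suc ℓ)) → Bool
  arrow zero    _       = false
  arrow (suc u) zero    = true
  arrow (suc u) (suc v) = distinct u v

  D : Digraph (suc (suc ℓ))
  D = record { arc = arrow ; loopless = λ { zero → refl ; (suc v) → distinct-irrefl v } }

  complete : ∀ u v → u ≢ v → Adjacent arrow u v
  complete zero    zero    u≢v = ⊥-elim (u≢v refl)
  complete zero    (suc v) _   = refl
  complete (suc u) zero    _   = refl
  complete (suc u) (suc v) u≢v = cong (_∨ distinct v u) (≢⇒distinct (λ eq → u≢v (cong suc eq)))

  open CompleteUnderlyingGraph D complete

  colour : Fin (suc (suc ℓ)) → Fin (suc ℓ)
  colour zero    = zero
  colour (suc v) = v

  rank : Fin (suc (suc ℓ)) → ℕ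
  rank zero    = 1
  rank (suc _) = 0

  rank< : ∀ v → rank v < 2
  rank< zero    = s≤s (s≤s z≤n)
  rank< (suc v) = s≤s z≤n

  ranked : Ranked arrow colour rank
  ranked zero    _       ()
  ranked (suc u) zero    _  _    = s≤s z≤n
  ranked (suc u) (suc v) uv refl = ⊥-elim (arc⇒≢ D {suc u} uv refl)

  degB-sink : degB D zero ≡ 0
  degB-sink = trans (degB≡∑ D zero) (∑-zeros (suc (suc ℓ)) (λ _ → refl))

  degB≡ℓ : ∀ v → degB D (suc v) ≡ ℓ
  degB≡ℓ v = trans (degB≡∑ D (suc v)) (trans (∑-cong (suc ℓ) (digonIndicator-distinct v)) (∑-all-but-one ℓ v))

  degB≤ℓ : ∀ v → degB D v ≤ ℓ
  degB≤ℓ zero    = subst (_≤ ℓ) (sym degB-sink) z≤n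
  degB≤ℓ (suc v) = ≤-reflexive (degB≡ℓ v)

  realisation : Realisation (suc (suc ℓ)) ℓ (suc ℓ)
  realisation = record
    { n = suc (suc ℓ) ; D = D
    ; height = toℕ ; heightBound = suc (suc ℓ) ; height< = toℕ<n ; proper = proper ; simplicial = simplicial
    ; label = λ _ u → u ; lowerLabelling = lowerLabelling ; clique = clique
    ; colour = colour ; rank = rank ; rankBound = 2 ; rank< = rank< ; ranked = ranked
    ; dichromatic≥ = symmetricClique⇒dichromatic≥ D suc (λ a b → ≢⇒distinct {u = a} {b})
    ; degB≤ = degB≤ℓ ; degB≡ = suc zero , degB≡ℓ zero
    }

module Extension {k ℓ c} (R : Realisation k ℓ c) where
  open Realisation R renaming (n to N; D to D₀)

  data V : Set where
    hub   : V
    core  : Fin N → V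
    petal : Fin N → Fin N → V

  arrow : V → V → Bool
  arrow hub         (core _)      = true
  arrow (core u)    (core v)      = arc D₀ u v
  arrow (core u)    (petal u′ _)  = does (u ≟ u′)
  arrow (petal _ _) hub           = true
  arrow (petal u w) (petal u′ w′) = does (u ≟ u′) ∧ arc D₀ w w′
  arrow _           _             = false

  arrow-loopless : ∀ a → arrow a a ≡ false
  arrow-loopless hub         = refl
  arrow-loopless (core v)    = loopless D₀ v
  arrow-loopless (petal u w) rewrite dec-true (u ≟ u) refl = loopless D₀ w

  n′ : ℕ
  n′ = suc (N + N * N)

  decodeTail : Fin N ⊎ Fin (N * N) → V
  decodeTail (inj₁ v) = core v
  decodeTail (inj₂ p) = uncurry petal (remQuot N p)

  decode : Fin n′ → V
  decode zero    = hub
  decode (suc i) = decodeTail (splitAt N i)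

  encode : V → Fin n′
  encode hub         = zero
  encode (core v)    = suc (v ↑ˡ N * N)
  encode (petal u w) = suc (N ↑ʳ combine u w)

  decode-encode : ∀ a → decode (encode a) ≡ a
  decode-encode hub         = refl
  decode-encode (core v)    rewrite splitAt-↑ˡ N v (N * N) = refl
  decode-encode (petal u w) rewrite splitAt-↑ʳ N (N * N) (combine u w) = cong (uncurry petal) (remQuot-combine u w)

  encode-decode : ∀ i → encode (decode i) ≡ i
  encode-decode zero    = refl
  encode-decode (suc i) = trans (encode-decodeTail (splitAt N i)) (cong suc (join-splitAt N (N * N) i))
    where
    encode-decodeTail : ∀ s → encode (decodeTail s) ≡ suc (join N (N * N) s)
    encode-decodeTail (inj₁ v) = refl
    encode-decodeTail (inj₂ p) = cong (λ q → suc (N ↑ʳ q)) (combine-remQuot {N} N p)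

  encode-injective : Injective _≡_ _≡_ encode
  encode-injective {a} {b} eq = trans (sym (decode-encode a)) (trans (cong decode eq) (decode-encode b))

  decode-injective : Injective _≡_ _≡_ decode
  decode-injective {i} {j} eq = trans (sym (encode-decode i)) (trans (cong encode eq) (encode-decode j))

  D′ : Digraph n′
  D′ = record { arc = λ i j → arrow (decode i) (decode j) ; loopless = λ i → arrow-loopless (decode i) }

  arc′-encode : ∀ a b → arc D′ (encode a) (encode b) ≡ arrow a b
  arc′-encode a b rewrite decode-encode a | decode-encode b = refl

  core-petal⇒same-centre : ∀ a u w → Adjacent arrow (core a) (petal u w) → a ≡ u
  core-petal⇒same-centre a u w adj with a ≟ u
  ... | yes a≡u = a≡u

  petal-petal⇒same-centre : ∀ u w u′ w′ → Adjacent arrow (petal u w) (petal u′ w′) → u ≡ u′ × Adjacent (arc D₀) w w′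
  petal-petal⇒same-centre u w u′ w′ adj with u ≟ u′
  ... | yes refl rewrite dec-true (u ≟ u) refl = refl , adj
  ... | no  u≢u′ rewrite dec-false (u′ ≟ u) (λ eq → u≢u′ (sym eq)) with () ← adj

  core-petal-adjacent : ∀ u w → Adjacent arrow (core u) (petal u w)
  core-petal-adjacent u w rewrite dec-true (u ≟ u) refl = refl

  petal-petal-adjacent : ∀ u {w w′} → Adjacent (arc D₀) w w′ → Adjacent arrow (petal u w) (petal u w′)
  petal-petal-adjacent u adj rewrite dec-true (u ≟ u) refl = adj

  height′ : V → ℕ
  height′ hub         = 0
  height′ (core v)    = suc (height v)
  height′ (petal _ w) = suc (heightBound + height w)

  height′< : ∀ a → height′ a < suc (heightBound + heightBound)
  height′< hub         = s≤s z≤n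
  height′< (core v)    = s≤s (≤-trans (height< v) (m≤m+n heightBound heightBound))
  height′< (petal u w) = s≤s (+-monoʳ-< heightBound (height< w))

  core<petal : ∀ v u w → height′ (core v) < height′ (petal u w)
  core<petal v u w = s≤s (≤-trans (height< v) (m≤m+n heightBound (height w)))

  proper′ : ProperHeights arrow height′
  proper′ hub         hub           ()  _
  proper′ hub         (core _)      _   ()
  proper′ hub         (petal _ _)   _   ()
  proper′ (core _)    hub           _   ()
  proper′ (petal _ _) hub           _   ()
  proper′ (core a)    (core b)      adj eq = proper a b adj (suc-injective eq)
  proper′ (core a)    (petal u w)   _   eq = <⇒≢ (core<petal a u w) eq
  proper′ (petal u w) (core a)      _   eq = <⇒≢ (core<petal a u w) (sym eq)
  proper′ (petal u w) (petal u′ w′) adj eq =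
    proper w w′ (proj₂ (petal-petal⇒same-centre u w u′ w′ adj)) (+-cancelˡ-≡ heightBound _ _ (suc-injective eq))

  -- The lower neighbours of a petal vertex are the hub, its centre, and lower neighbours inside its petal.
  simplicial′ : SimplicialHeights arrow height′
  simplicial′ hub _ _ (_ , ()) _
  simplicial′ (core a) (petal u w) _ (_ , h<) _ _ = ⊥-elim (<-asym h< (core<petal a u w))
  simplicial′ (core a) _ (petal u w) _ (_ , h<) _ = ⊥-elim (<-asym h< (core<petal a u w))
  simplicial′ (core a) hub      hub       _ _ u≢w = ⊥-elim (u≢w refl)
  simplicial′ (core a) hub      (core _)  _ _ _   = refl
  simplicial′ (core a) (core _) hub       _ _ _   = refl
  simplicial′ (core a) (core b) (core b′) (ba , h<) (b′a , h′<) b≢b′ =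
    simplicial a b b′ (ba , ≤-pred h<) (b′a , ≤-pred h′<) (λ eq → b≢b′ (cong core eq))
  simplicial′ (petal _ _) hub         hub         _ _ u≢w = ⊥-elim (u≢w refl)
  simplicial′ (petal _ _) hub         (core _)    _ _ _   = refl
  simplicial′ (petal _ _) hub         (petal _ _) _ _ _   = refl
  simplicial′ (petal _ _) (core _)    hub         _ _ _   = refl
  simplicial′ (petal _ _) (petal _ _) hub         _ _ _   = refl
  simplicial′ (petal u w) (core b) (core b′) (bp , _) (b′p , _) b≢b′
    with refl ← core-petal⇒same-centre b u w bp | refl ← core-petal⇒same-centre b′ u w b′p = ⊥-elim (b≢b′ refl)
  simplicial′ (petal u w) (core b) (petal u₂ w₂) (bp , _) (wp , _) _
    with refl ← core-petal⇒same-centre b u w bp | refl , _ ← petal-petal⇒same-centre u₂ w₂ u w wp = core-petal-adjacent b w₂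
  simplicial′ (petal u w) (petal u₁ w₁) (core b) (wp , _) (bp , _) _
    with refl ← core-petal⇒same-centre b u w bp | refl , _ ← petal-petal⇒same-centre u₁ w₁ u w wp =
    Adjacent-sym arrow {core b} {petal b w₁} (core-petal-adjacent b w₁)
  simplicial′ (petal u w) (petal u₁ w₁) (petal u₂ w₂) (p₁ , h₁<) (p₂ , h₂<) ne
    with refl , w₁w ← petal-petal⇒same-centre u₁ w₁ u w p₁ | refl , w₂w ← petal-petal⇒same-centre u₂ w₂ u w p₂ =
    petal-petal-adjacent u (simplicial w w₁ w₂ (w₁w , shift h₁<) (w₂w , shift h₂<) (λ eq → ne (cong (petal u) eq)))
    where shift : ∀ {x y} → suc (heightBound + x) < suc (heightBound + y) → x < y
          shift lt = +-cancelˡ-< heightBound _ _ (≤-pred lt)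

  label′ : V → V → Fin (suc (suc k))
  label′ (core a)    (core b)     = suc (suc (label a b))
  label′ (petal _ _) (core _)     = suc zero
  label′ (petal _ w) (petal _ w′) = suc (suc (label w w′))
  label′ _           _            = zero

  hub-closed : ∀ u → ClosedLowerNeighbour arrow height′ hub u → u ≡ hub
  hub-closed _ (inj₁ u≡hub) = u≡hub

  core-closed-core : ∀ a b → ClosedLowerNeighbour arrow height′ (core a) (core b) → ClosedLowerNeighbour (arc D₀) height a b
  core-closed-core a b (inj₁ refl)      = inj₁ refl
  core-closed-core a b (inj₂ (ba , h<)) = inj₂ (ba , ≤-pred h<)

  core-closed-petal : ∀ a u w → ¬ ClosedLowerNeighbour arrow height′ (core a) (petal u w)
  core-closed-petal a u w (inj₂ (_ , h<)) = <-asym h< (core<petal a u w)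

  petal-closed-core : ∀ u w b → ClosedLowerNeighbour arrow height′ (petal u w) (core b) → b ≡ u
  petal-closed-core u w b (inj₂ (bp , _)) = core-petal⇒same-centre b u w bp

  petal-closed-petal : ∀ u w u′ w′ → ClosedLowerNeighbour arrow height′ (petal u w) (petal u′ w′) →
                       u′ ≡ u × ClosedLowerNeighbour (arc D₀) height w w′
  petal-closed-petal u w u′ w′ (inj₁ refl)      = refl , inj₁ refl
  petal-closed-petal u w u′ w′ (inj₂ (pp , h<)) =
    proj₁ (petal-petal⇒same-centre u′ w′ u w pp) ,
    inj₂ (proj₂ (petal-petal⇒same-centre u′ w′ u w pp) , +-cancelˡ-< heightBound _ _ (≤-pred h<))

  lowerLabelling′ : LowerLabelling arrow height′ label′
  lowerLabelling′ hub u u′ c c′ _ = trans (hub-closed u c) (sym (hub-closed u′ c′))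
  lowerLabelling′ (core a) (petal u w) _ c _ _ = ⊥-elim (core-closed-petal a u w c)
  lowerLabelling′ (core a) _ (petal u w) _ c _ = ⊥-elim (core-closed-petal a u w c)
  lowerLabelling′ (core a) hub      hub       _ _ _ = refl
  lowerLabelling′ (core a) hub      (core _)  _ _ ()
  lowerLabelling′ (core a) (core _) hub       _ _ ()
  lowerLabelling′ (core a) (core b) (core b′) c c′ eq =
    cong core (lowerLabelling a b b′ (core-closed-core a b c) (core-closed-core a b′ c′) (Fin-suc-injective (Fin-suc-injective eq)))
  lowerLabelling′ (petal u w) hub         hub         _ _ _ = refl
  lowerLabelling′ (petal u w) hub         (core _)    _ _ ()
  lowerLabelling′ (petal u w) hub         (petal _ _) _ _ ()
  lowerLabelling′ (petal u w) (core _)    hub         _ _ ()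
  lowerLabelling′ (petal u w) (core _)    (petal _ _) _ _ ()
  lowerLabelling′ (petal u w) (petal _ _) hub         _ _ ()
  lowerLabelling′ (petal u w) (petal _ _) (core _)    _ _ ()
  lowerLabelling′ (petal u w) (core b) (core b′) c c′ _ =
    cong core (trans (petal-closed-core u w b c) (sym (petal-closed-core u w b′ c′)))
  lowerLabelling′ (petal u w) (petal u₁ w₁) (petal u₂ w₂) c₁ c₂ eq
    with refl , d₁ ← petal-closed-petal u w u₁ w₁ c₁ | refl , d₂ ← petal-closed-petal u w u₂ w₂ c₂ =
    cong (petal u) (lowerLabelling w w₁ w₂ d₁ d₂ (Fin-suc-injective (Fin-suc-injective eq)))

  encode-adjacent : ∀ a b → Adjacent arrow a b → Adjacent (arc D′) (encode a) (encode b)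
  encode-adjacent a b adj rewrite decode-encode a | decode-encode b = adj

  u₀ : Fin N
  u₀ = proj₁ degB≡

  clique-vertex : Fin (suc (suc k)) → V
  clique-vertex zero          = hub
  clique-vertex (suc zero)    = core u₀
  clique-vertex (suc (suc i)) = petal u₀ (proj₁ clique i)

  clique-vertex-injective : Injective _≡_ _≡_ clique-vertex
  clique-vertex-injective {zero}          {zero}          _  = refl
  clique-vertex-injective {suc zero}      {suc zero}      _  = refl
  clique-vertex-injective {suc (suc i)}   {suc (suc j)}   eq =
    cong (λ i → suc (suc i)) (proj₁ (proj₂ clique) (petal-injective eq))
    where petal-injective : ∀ {w w′} → petal u₀ w ≡ petal u₀ w′ → w ≡ w′
          petal-injective refl = refl
  clique-vertex-injective {zero}          {suc zero}      ()
  clique-vertex-injective {zero}          {suc (suc _)}   ()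
  clique-vertex-injective {suc zero}      {zero}          ()
  clique-vertex-injective {suc zero}      {suc (suc _)}   ()
  clique-vertex-injective {suc (suc _)}   {zero}          ()
  clique-vertex-injective {suc (suc _)}   {suc zero}      ()

  clique-vertex-adjacent : ∀ i j → i ≢ j → Adjacent arrow (clique-vertex i) (clique-vertex j)
  clique-vertex-adjacent zero          zero          i≢j = ⊥-elim (i≢j refl)
  clique-vertex-adjacent (suc zero)    (suc zero)    i≢j = ⊥-elim (i≢j refl)
  clique-vertex-adjacent zero          (suc zero)    _   = refl
  clique-vertex-adjacent zero          (suc (suc _)) _   = refl
  clique-vertex-adjacent (suc zero)    zero          _   = refl
  clique-vertex-adjacent (suc (suc _)) zero          _   = refl
  clique-vertex-adjacent (suc zero)    (suc (suc j)) _   = core-petal-adjacent u₀ (proj₁ clique j)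
  clique-vertex-adjacent (suc (suc i)) (suc zero)    _   =
    Adjacent-sym arrow {core u₀} {petal u₀ (proj₁ clique i)} (core-petal-adjacent u₀ (proj₁ clique i))
  clique-vertex-adjacent (suc (suc i)) (suc (suc j)) i≢j =
    petal-petal-adjacent u₀ (proj₂ (proj₂ clique) i j (λ eq → i≢j (cong (λ i → suc (suc i)) eq)))

  clique′ : HasClique (UG D′) (suc (suc k))
  clique′ = (λ i → encode (clique-vertex i)) , (λ eq → clique-vertex-injective (encode-injective eq)) ,
            (λ i j i≢j → encode-adjacent (clique-vertex i) (clique-vertex j) (clique-vertex-adjacent i j i≢j))

  colour′ : V → Fin (suc c)
  colour′ hub         = zero
  colour′ (core v)    = suc (colour v)
  colour′ (petal _ w) = suc (colour w)

  rank′ : V → ℕ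
  rank′ hub         = 0
  rank′ (core v)    = rank v
  rank′ (petal _ w) = rankBound + rank w

  rank′< : ∀ a → rank′ a < suc (rankBound + rankBound)
  rank′< hub         = s≤s z≤n
  rank′< (core v)    = m<n⇒m<1+n (≤-trans (rank< v) (m≤m+n rankBound rankBound))
  rank′< (petal _ w) = m<n⇒m<1+n (+-monoʳ-< rankBound (rank< w))

  ranked′ : Ranked arrow colour′ rank′
  ranked′ hub         hub           ()
  ranked′ hub         (core _)      _  ()
  ranked′ hub         (petal _ _)   ()
  ranked′ (core _)    hub           ()
  ranked′ (petal _ _) hub           _  ()
  ranked′ (petal _ _) (core _)      ()
  ranked′ (core a)    (core b)      ab eq = ranked a b ab (Fin-suc-injective eq)
  ranked′ (core a)    (petal _ w)   _  _  = ≤-trans (rank< a) (m≤m+n rankBound (rank w))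
  ranked′ (petal u w) (petal u′ w′) ab eq with u ≟ u′
  ... | yes _ = +-monoʳ-< rankBound (ranked w w′ ab (Fin-suc-injective eq))
  ranked′ (petal u w) (petal u′ w′) () eq | no _

  core-dicolouring : ∀ {j} col → IsDicolouring D′ j col → IsDicolouring D₀ j (λ v → col (encode (core v)))
  core-dicolouring {j} col = dicolouring-pullback D₀ D′ (λ v → encode (core v))
    (λ eq → core-injective (encode-injective eq)) (λ a b ab → trans (arc′-encode (core a) (core b)) ab) {j} {col}
    where core-injective : ∀ {a b} → core a ≡ core b → a ≡ b
          core-injective refl = refl

  petal-dicolouring : ∀ u {j} col → IsDicolouring D′ j col → IsDicolouring D₀ j (λ w → col (encode (petal u w)))
  petal-dicolouring u {j} col = dicolouring-pullback D₀ D′ (λ w → encode (petal u w))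
    (λ eq → petal-injective (encode-injective eq))
    (λ a b ab → trans (arc′-encode (petal u a) (petal u b)) (trans (cong (_∧ arc D₀ a b) (dec-true (u ≟ u) refl)) ab)) {j} {col}
    where petal-injective : ∀ {a b} → petal u a ≡ petal u b → a ≡ b
          petal-injective refl = refl

  dichromatic≥′ : ∀ j → HasDicolouring D′ j → suc c ≤ j
  dichromatic≥′ j (col , dic) with m≤n⇒m<n∨m≡n (dichromatic≥ j (col-core , core-dicolouring col dic))
    where col-core = λ v → col (encode (core v))
  ... | inj₁ c<j  = c<j
  ... | inj₂ refl = ⊥-elim (no-monochromatic-triangle D′ {col = col} {encode hub} {encode (core u)} {encode (petal u w)} dic
          (arc′-encode hub (core u)) (trans (arc′-encode (core u) (petal u w)) (dec-true (u ≟ u) refl))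
          (arc′-encode (petal u w) hub) (proj₂ core-hit) (proj₂ petal-hit))
    where
    core-hit = minimumDicolouring-surjective D₀ dichromatic≥ {col = λ v → col (encode (core v))}
                 (core-dicolouring col dic) ≤-refl (col (encode hub))
    u = proj₁ core-hit
    petal-hit = minimumDicolouring-surjective D₀ dichromatic≥ {col = λ w → col (encode (petal u w))}
                  (petal-dicolouring u col dic) ≤-refl (col (encode hub))
    w = proj₁ petal-hit

  digon : V → V → ℕ
  digon a b = if arrow a b ∧ arrow b a then 1 else 0

  degree′ : V → ℕ
  degree′ hub         = 0
  degree′ (core v)    = degB D₀ v
  degree′ (petal _ w) = degB D₀ w

  ∑-decode : ∀ (g : V → ℕ) → ∑ n′ (λ i → g (decode i)) ≡ g hub + (∑ N (λ v → g (core v)) + ∑ N (λ u → ∑ N (λ w → g (petal u w))))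
  ∑-decode g = cong (g hub +_) (trans (∑-↑ N (N * N) _) (cong₂ _+_
    (∑-cong N (λ v → cong g (decode-encode (core v))))
    (trans (∑-combine N N _) (∑-cong N (λ u → ∑-cong N (λ w → cong g (decode-encode (petal u w))))))))

  petal-row : ∀ u w u′ → ∑ N (λ w′ → digon (petal u w) (petal u′ w′)) ≡ (if does (u ≟ u′) then degB D₀ w else 0)
  petal-row u w u′ with u ≟ u′
  ... | yes refl rewrite dec-true (u ≟ u) refl = sym (degB≡∑ D₀ w)
  ... | no  _    = ∑-zeros N (λ _ → refl)

  digon-sum : ∀ a → digon a hub + (∑ N (λ v → digon a (core v)) + ∑ N (λ u → ∑ N (λ w → digon a (petal u w)))) ≡ degree′ a
  digon-sum hub = cong₂ _+_ (∑-zeros N (λ _ → refl)) (∑-zeros N (λ _ → ∑-zeros N (λ _ → refl)))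
  digon-sum (core v) = trans (cong₂ _+_ (sym (degB≡∑ D₀ v)) petals) (+-identityʳ _)
    where petals = ∑-zeros N (λ u → ∑-zeros N (λ w → cong (λ b → if b then 1 else 0) (∧-zeroʳ (does (v ≟ u)))))
  digon-sum (petal u w) = cong₂ _+_ (∑-zeros N (λ _ → refl)) (trans (∑-cong N (petal-row u w)) (∑-single N u (degB D₀ w)))

  degB′ : ∀ i → degB D′ i ≡ degree′ (decode i)
  degB′ i = trans (degB≡∑ D′ i) (trans (∑-decode (digon (decode i))) (digon-sum (decode i)))

  degree′≤ : ∀ a → degree′ a ≤ ℓ
  degree′≤ hub         = z≤n
  degree′≤ (core v)    = degB≤ v
  degree′≤ (petal _ w) = degB≤ w

  realisation : Realisation (suc (suc k)) ℓ (suc c)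
  realisation = record
    { n = n′ ; D = D′
    ; height = λ i → height′ (decode i) ; heightBound = suc (heightBound + heightBound) ; height< = λ i → height′< (decode i)
    ; proper = λ u v → proper′ (decode u) (decode v)
    ; simplicial = λ v u w u<v w<v u≢w → simplicial′ (decode v) (decode u) (decode w) u<v w<v (λ eq → u≢w (decode-injective eq))
    ; label = λ v u → label′ (decode v) (decode u)
    ; lowerLabelling = λ v u u′ c c′ eq → decode-injective (lowerLabelling′ (decode v) (decode u) (decode u′) (closed c) (closed c′) eq)
    ; clique = clique′
    ; colour = λ i → colour′ (decode i) ; rank = λ i → rank′ (decode i)
    ; rankBound = suc (rankBound + rankBound) ; rank< = λ i → rank′< (decode i)
    ; ranked = λ u v → ranked′ (decode u) (decode v)
    ; dichromatic≥ = dichromatic≥′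
    ; degB≤ = λ i → ≤-trans (≤-reflexive (degB′ i)) (degree′≤ (decode i))
    ; degB≡ = encode (core u₀) , trans (degB′ (encode (core u₀))) (trans (cong degree′ (decode-encode (core u₀))) (proj₂ degB≡))
    }
    where
    closed : ∀ {v u} → ClosedLowerNeighbour (arc D′) (λ i → height′ (decode i)) v u →
             ClosedLowerNeighbour arrow height′ (decode v) (decode u)
    closed (inj₁ u≡v)  = inj₁ (cong decode u≡v)
    closed (inj₂ lower) = inj₂ lower


⌊n+n/2⌋≡n : ∀ n → ⌊ n + n /2⌋ ≡ n
⌊n+n/2⌋≡n zero    = refl
⌊n+n/2⌋≡n (suc n) = trans (cong (λ m → ⌊ suc m /2⌋) (+-suc n n)) (cong suc (⌊n+n/2⌋≡n n))

⌈n+n/2⌉≡n : ∀ n → ⌈ n + n /2⌉ ≡ n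
⌈n+n/2⌉≡n zero    = refl
⌈n+n/2⌉≡n (suc n) = trans (cong (λ m → ⌈ suc m /2⌉) (+-suc n n)) (cong suc (⌈n+n/2⌉≡n n))

-- Each extension raises k by 2 and ⌈(k + ℓ)/2⌉ by 1, so two base cases cover both parities of k + ℓ.
realisation : ∀ ℓ d → Realisation (d + suc ℓ) ℓ ⌈ d + suc ℓ + ℓ /2⌉
realisation ℓ zero          = subst (Realisation (suc ℓ) ℓ) (cong suc (sym (⌊n+n/2⌋≡n ℓ))) (CompleteSymmetric.realisation ℓ)
realisation ℓ (suc zero)    = subst (Realisation (suc (suc ℓ)) ℓ) (cong suc (sym (⌈n+n/2⌉≡n ℓ))) (CompleteSymmetricWithSink.realisation ℓ)
realisation ℓ (suc (suc d)) = Extension.realisation (realisation ℓ d)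

mainTheorem4 : (k ℓ : ℕ) → ℓ + 1 ≤ k →
    Σ ℕ λ n → Σ (Graph n) λ G → Σ (Digraph n) λ D →
      Chordal G × IsSuperOrientation G D × CliqueNumber≡ G k
        × MaxDegB≡ D ℓ × Dichromatic≡ D ⌈ k + ℓ /2⌉
mainTheorem4 k ℓ ℓ+1≤k =
  realisation⇒example (subst (λ k → Realisation k ℓ ⌈ k + ℓ /2⌉) (m∸n+n≡m ℓ<k) (realisation ℓ (k ∸ suc ℓ)))
  where
  ℓ<k : suc ℓ ≤ k
  ℓ<k = subst (_≤ k) (+-comm ℓ 1) ℓ+1≤k
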